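{- Let $n$ be a positive integer and $k$ a nonnegative integer. Let $t_{n,k}$ be the coefficient of $x^{n-k+1}$ in the Chebyshev polynomial of the first kind $T_{n+k+1}(x)$. Then $(-1)^k t_{n,k}$ equals the number of $u(n+1,k,x)$-sequences. Moreover, \[(-1)^kt_{n,k}=\sum_{i=0}^n(-1)^i{n\choose i}{2n-2i+1\choose n+k}\] and \[(-1)^kt_{n,k}=2^{n-k}\left[{n\choose k}+2{n\choose k-1} \right].\]
   Context: $T_N(x)$ denotes the Chebyshev polynomial of the first kind, determined by $T_N(\cos\theta)=\cos(N\theta)$. Let $x$ be a symbol. A $u(N,k,x)$-sequence is a sequence of length $N$ whose terms are drawn from the three symbols $x$, $1$, and $1|$ (the latter a single term, "$1$ followed by a bar"), such that exactly $k$ terms equal $x$, all other terms are $1$ or $1|$, and the last term is not $1|$. Binomial coefficients ${a\choose b}$ are $0$ when $b<0$ or $b>a$. -}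

module Defs where

open import Data.Nat as ℕ using (ℕ; zero; suc)
open import Data.Nat.Properties using (m^n≢0)
open import Data.Nat.Combinatorics using (_C_)
open import Data.Integer as ℤ using (ℤ; +_; -[1+_])
open import Data.Rational as ℚ using (ℚ)
open import Data.Bool using (Bool; true; false; _∧_)
open import Data.List using (List; []; _∷_; map; foldr; length; filterᵇ; concatMap; upTo)
open import Data.Vec using (Vec; []; _∷_)

-- chebCoeff N j = coefficient of x^j in the Chebyshev polynomial T_N(x),
-- computed from T_0 = 1, T_1 = x, T_{N+2} = 2x T_{N+1} - T_N.
chebCoeff : ℕ → ℕ → ℤ
chebCoeff zero zero = + 1
chebCoeff zero (suc j) = + 0
chebCoeff (suc zero) zero = + 0
chebCoeff (suc zero) (suc zero) = + 1
chebCoeff (suc zero) (suc (suc j)) = + 0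
chebCoeff (suc (suc N)) zero = ℤ.- chebCoeff N zero
chebCoeff (suc (suc N)) (suc j) = (+ 2 ℤ.* chebCoeff (suc N) j) ℤ.- chebCoeff N (suc j)

chebCoeffℤ : ℕ → ℤ → ℤ
chebCoeffℤ N (+ j) = chebCoeff N j
chebCoeffℤ N -[1+ j ] = + 0

t : ℕ → ℕ → ℤ
t n k = chebCoeffℤ (n ℕ.+ k ℕ.+ 1) ((+ n) ℤ.- (+ k) ℤ.+ + 1)

sgn : ℕ → ℤ
sgn k = (ℤ.- + 1) ℤ.^ k

data Sym : Set where
  X One OneBar : Sym

isX : Sym → Bool
isX X = true
isX _ = false

isBar : Sym → Bool
isBar OneBar = true
isBar _ = false

not : Bool → Bool
not true = false
not false = true

allSeqs : (N : ℕ) → List (Vec Sym N)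
allSeqs zero = [] ∷ []
allSeqs (suc N) = concatMap (λ v → (X ∷ v) ∷ (One ∷ v) ∷ (OneBar ∷ v) ∷ []) (allSeqs N)

countX : ∀ {N} → Vec Sym N → ℕ
countX [] = 0
countX (s ∷ v) = (if isX s then 1 else 0) ℕ.+ countX v
  where
  open import Data.Bool using (if_then_else_)

lastNotBar : ∀ {N} → Vec Sym N → Bool
lastNotBar [] = true
lastNotBar (s ∷ []) = not (isBar s)
lastNotBar (s ∷ s' ∷ v) = lastNotBar (s' ∷ v)

isU : ∀ {N} → ℕ → Vec Sym N → Bool
isU k v = (countX v ℕ.≡ᵇ k) ∧ lastNotBar v

numU : ℕ → ℕ → ℕ
numU N k = length (filterᵇ (isU k) (allSeqs N))

sumℤ : ℕ → (ℕ → ℤ) → ℤ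
sumℤ m f = foldr ℤ._+_ (+ 0) (map f (upTo m))

binomℤ : ℕ → ℤ → ℤ
binomℤ a (+ b) = + (a C b)
binomℤ a -[1+ b ] = + 0

pow2 : ℤ → ℚ
pow2 (+ m) = (+ (2 ℕ.^ m)) ℚ./ 1
pow2 -[1+ m ] = ℚ._/_ (+ 1) (2 ℕ.^ suc m) {{m^n≢0 2 (suc m)}}

module Submission where

-- All three quantities are identified with one table U L k, defined by the
-- recursion U(L+2,k+1) = U(L+1,k) + 2 U(L+1,k+1), U(L+2,0) = 2 U(L+1,0):
--  * Chebyshev: the three-term recurrence T_{N+2} = 2x T_{N+1} - T_N restricted
--    to the coefficient of x^j in T_{j+2k} is, up to the sign (-1)^k, the
--    recursion of U (the coefficients above the degree vanish);
--  * Enumeration: deleting the first term of a sequence of length L+2 gives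
--    the same recursion (an initial x uses up one x, 1 and 1| do not);
--  * Alternating sum: Σ_i (-1)^i C(n,i) h(i) is the n-th iterated difference
--    of h, and by Pascal's rule applied twice these differences of
--    i ↦ C(2n-2i+1, R) satisfy the same recursion in (n, R);
--  * Closed form: 2^k U(n+1,k) = 2^n [C(n,k) + 2 C(n,k-1)] by Pascal's rule.

open import Defs
open import Data.Nat as ℕ using (ℕ; suc; _∸_; NonZero)
open import Data.Nat.Combinatorics using (_C_)
open import Data.Integer as ℤ using (ℤ; +_)
open import Data.Rational as ℚ using (ℚ)
open import Data.Product using (_×_)
open import Relation.Binary.PropositionalEquality using (_≡_)

open import Data.Nat using (zero; z≤n; s≤s)
import Data.Nat.Properties as ℕP
open import Data.Nat.Combinatorics using (nCk+nC[k+1]≡[n+1]C[k+1]; k>n⇒nCk≡0; nCn≡1; nC1≡n)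
open import Data.Nat.Coprimality using (1-coprimeTo) renaming (sym to coprime-sym)
open import Data.Integer using (-[1+_]; _⊖_)
import Data.Integer.Properties as ℤP
import Data.Rational.Properties as ℚP
open import Data.Bool using (Bool; true; false)
open import Data.List using (List; []; _∷_; map; foldr; length; filterᵇ; concatMap; applyUpTo)
open import Data.Vec using (Vec; _∷_)
open import Data.Product using (_,_)
open import Relation.Binary.PropositionalEquality using (refl; sym; trans; cong; cong₂; module ≡-Reasoning)
open import Relation.Binary.Definitions using (Tri; tri<; tri≈; tri>)
open import Relation.Nullary using (yes; no)
import Data.Nat.Tactic.RingSolver as ℕRing
import Data.Integer.Tactic.RingSolver as ℤRing

module Table where
  open import Data.Nat using (_+_; _*_; _<_)

  -- U L k will turn out to be the number of u(L,k,x)-sequences.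
  U : ℕ → ℕ → ℕ
  U 0 0 = 1
  U 0 (suc k) = 0
  U 1 0 = 1
  U 1 1 = 1
  U 1 (suc (suc k)) = 0
  U (suc (suc L)) 0 = 2 * U (suc L) 0
  U (suc (suc L)) (suc k) = U (suc L) k + 2 * U (suc L) (suc k)

  U-vanish : ∀ L k → L < k → U L k ≡ 0
  U-vanish 0 (suc k) _ = refl
  U-vanish 1 (suc (suc k)) _ = refl
  U-vanish 1 1 (s≤s ())
  U-vanish (suc (suc L)) (suc k) (s≤s L+1<k) =
    cong₂ (λ a b → a + 2 * b) (U-vanish (suc L) k L+1<k)
                              (U-vanish (suc L) (suc k) (ℕP.m<n⇒m<1+n L+1<k))

  U-diag : ∀ L → U L L ≡ 1
  U-diag 0 = refl
  U-diag 1 = refl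
  U-diag (suc (suc L)) =
    cong₂ (λ a b → a + 2 * b) (U-diag (suc L)) (U-vanish (suc L) (suc (suc L)) (ℕP.n<1+n (suc L)))

open Table

module TableInℤ where
  open import Data.Integer using (_+_; _*_)

  U-stepℤ : ∀ L k → + U (suc (suc L)) (suc k) ≡ + U (suc L) k + + 2 * + U (suc L) (suc k)
  U-stepℤ L k = trans (ℤP.pos-+ (U (suc L) k) _) (cong (λ z → + U (suc L) k + z) (ℤP.pos-* 2 (U (suc L) (suc k))))

  U-step₀ℤ : ∀ L → + U (suc (suc L)) 0 ≡ + 2 * + U (suc L) 0
  U-step₀ℤ L = ℤP.pos-* 2 (U (suc L) 0)

open TableInℤ


module Enumeration where
  open import Data.Nat using (_+_; _*_)

  count : {A : Set} → (A → Bool) → List A → ℕ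
  count p xs = length (filterᵇ p xs)

  indicator : Bool → ℕ
  indicator true = 1
  indicator false = 0

  count-∷ : {A : Set} (p : A → Bool) (x : A) (xs : List A) →
            count p (x ∷ xs) ≡ indicator (p x) + count p xs
  count-∷ p x xs with p x
  ... | true = refl
  ... | false = refl

  count-cong : {A : Set} {p q : A → Bool} → (∀ x → p x ≡ q x) → ∀ xs → count p xs ≡ count q xs
  count-cong e [] = refl
  count-cong {p = p} {q} e (x ∷ xs) =
    trans (count-∷ p x xs)
          (trans (cong₂ (λ b c → indicator b + c) (e x) (count-cong e xs)) (sym (count-∷ q x xs)))

  count-none : {A : Set} {p : A → Bool} → (∀ x → p x ≡ false) → ∀ xs → count p xs ≡ 0
  count-none e [] = refl
  count-none {p = p} e (x ∷ xs) =
    trans (count-∷ p x xs) (cong₂ (λ b c → indicator b + c) (e x) (count-none e xs))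

  extend : ∀ {N} → Vec Sym N → List (Vec Sym (suc N))
  extend v = (X ∷ v) ∷ (One ∷ v) ∷ (OneBar ∷ v) ∷ []

  count-extend : ∀ {N} (p : Vec Sym (suc N) → Bool) (vs : List (Vec Sym N)) →
    count p (concatMap extend vs)
      ≡ count (λ v → p (X ∷ v)) vs + count (λ v → p (One ∷ v)) vs + count (λ v → p (OneBar ∷ v)) vs
  count-extend p [] = refl
  count-extend p (v ∷ vs) = begin
      count p ((X ∷ v) ∷ (One ∷ v) ∷ (OneBar ∷ v) ∷ rest)
    ≡⟨ count-∷ p _ _ ⟩
      a + count p ((One ∷ v) ∷ (OneBar ∷ v) ∷ rest)
    ≡⟨ cong (λ z → a + z) (count-∷ p _ _) ⟩
      a + (b + count p ((OneBar ∷ v) ∷ rest))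
    ≡⟨ cong (λ z → a + (b + z)) (count-∷ p _ _) ⟩
      a + (b + (c + count p rest))
    ≡⟨ cong (λ z → a + (b + (c + z))) (count-extend p vs) ⟩
      a + (b + (c + (cX + cO + cB)))
    ≡⟨ regroup a b c cX cO cB ⟩
      (a + cX) + (b + cO) + (c + cB)
    ≡⟨ cong₂ _+_ (cong₂ _+_ (count-∷ pX v vs) (count-∷ pO v vs)) (count-∷ pB v vs) ⟨
      count pX (v ∷ vs) + count pO (v ∷ vs) + count pB (v ∷ vs) ∎
    where
    open ≡-Reasoning
    pX pO pB : _ → Bool
    pX w = p (X ∷ w)
    pO w = p (One ∷ w)
    pB w = p (OneBar ∷ w)
    rest = concatMap extend vs
    a = indicator (pX v)
    b = indicator (pO v)
    c = indicator (pB v)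
    cX = count pX vs
    cO = count pO vs
    cB = count pB vs
    regroup : ∀ a b c x y z → a + (b + (c + (x + y + z))) ≡ (a + x) + (b + y) + (c + z)
    regroup = ℕRing.solve-∀

  -- Removing the first term of a sequence of length at least 2: an initial
  -- x accounts for one x, and an initial 1 or 1| is not the last term.
  isU-X : ∀ {N} k (v : Vec Sym (suc N)) → isU (suc k) (X ∷ v) ≡ isU k v
  isU-X k (s ∷ v) = refl

  isU-X₀ : ∀ {N} (v : Vec Sym (suc N)) → isU 0 (X ∷ v) ≡ false
  isU-X₀ (s ∷ v) = refl

  isU-One : ∀ {N} k (v : Vec Sym (suc N)) → isU k (One ∷ v) ≡ isU k v
  isU-One k (s ∷ v) = refl

  isU-OneBar : ∀ {N} k (v : Vec Sym (suc N)) → isU k (OneBar ∷ v) ≡ isU k v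
  isU-OneBar k (s ∷ v) = refl

  -- The initial 1's and 1|'s contribute two copies of the count for length L+1.
  numU-step : ∀ L k →
    numU (suc (suc L)) k ≡ count (λ v → isU k (X ∷ v)) (allSeqs (suc L)) + 2 * numU (suc L) k
  numU-step L k = begin
      count (isU k) (concatMap extend S)
    ≡⟨ count-extend (isU k) S ⟩
      cX + count (λ v → isU k (One ∷ v)) S + count (λ v → isU k (OneBar ∷ v)) S
    ≡⟨ cong₂ (λ b c → cX + b + c) (count-cong (isU-One k) S) (count-cong (isU-OneBar k) S) ⟩
      cX + numU (suc L) k + numU (suc L) k
    ≡⟨ double cX (numU (suc L) k) ⟩
      cX + 2 * numU (suc L) k ∎
    where
    open ≡-Reasoning
    S = allSeqs (suc L)
    cX = count (λ v → isU k (X ∷ v)) S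
    double : ∀ a b → a + b + b ≡ a + 2 * b
    double = ℕRing.solve-∀

  numU-U : ∀ L k → numU L k ≡ U L k
  numU-U 0 0 = refl
  numU-U 0 (suc k) = refl
  numU-U 1 0 = refl
  numU-U 1 1 = refl
  numU-U 1 (suc (suc k)) = refl
  numU-U (suc (suc L)) 0 =
    trans (numU-step L 0)
          (cong₂ (λ a b → a + 2 * b) (count-none isU-X₀ (allSeqs (suc L))) (numU-U (suc L) 0))
  numU-U (suc (suc L)) (suc k) =
    trans (numU-step L (suc k))
          (cong₂ (λ a b → a + 2 * b) (trans (count-cong (isU-X k) (allSeqs (suc L))) (numU-U (suc L) k))
                                     (numU-U (suc L) (suc k)))

open Enumeration using (numU-U)

module Chebyshev where
  open import Data.Integer using (_+_; _*_; _-_; -_)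
  open ≡-Reasoning

  sgn-suc : ∀ k x → sgn (suc k) * x ≡ - (sgn k * x)
  sgn-suc k x = negate (sgn k) x
    where
    negate : ∀ s x → (- + 1 * s) * x ≡ - (s * x)
    negate = ℤRing.solve-∀

  sgn-square : ∀ k → sgn k * sgn k ≡ + 1
  sgn-square zero = refl
  sgn-square (suc k) = trans (square-neg (sgn k)) (sgn-square k)
    where
    square-neg : ∀ s → (- + 1 * s) * (- + 1 * s) ≡ s * s
    square-neg = ℤRing.solve-∀

  chebCoeff-vanish : ∀ N j → N ℕ.< j → chebCoeff N j ≡ + 0
  chebCoeff-vanish 0 (suc j) _ = refl
  chebCoeff-vanish 1 (suc (suc j)) _ = refl
  chebCoeff-vanish 1 1 (s≤s ())
  chebCoeff-vanish (suc (suc N)) (suc j) (s≤s N+1<j) =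
    cong₂ (λ a b → + 2 * a - b)
          (chebCoeff-vanish (suc N) j N+1<j)
          (chebCoeff-vanish N (suc j) (ℕP.<-trans (ℕP.n<1+n N) (ℕP.m<n⇒m<1+n N+1<j)))

  chebCoeff-leading : ∀ j → chebCoeff j j ≡ + U j 0
  chebCoeff-leading 0 = refl
  chebCoeff-leading 1 = refl
  chebCoeff-leading (suc (suc j)) = begin
      + 2 * chebCoeff (suc j) (suc j) - chebCoeff j (suc (suc j))
    ≡⟨ cong₂ (λ a b → + 2 * a - b) (chebCoeff-leading (suc j))
                                  (chebCoeff-vanish j (suc (suc j)) (ℕP.m<n⇒m<1+n (ℕP.n<1+n j))) ⟩
      + 2 * + U (suc j) 0 + + 0
    ≡⟨ ℤP.+-identityʳ _ ⟩
      + 2 * + U (suc j) 0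
    ≡⟨ U-step₀ℤ j ⟨
      + U (suc (suc j)) 0 ∎

  chebCoeff-U : ∀ k j → chebCoeff (j ℕ.+ k ℕ.+ k) j ≡ sgn k * + U (j ℕ.+ k) k
  chebCoeff-U zero j = begin
      chebCoeff (j ℕ.+ 0 ℕ.+ 0) j
    ≡⟨ cong (λ N → chebCoeff N j) (trans (ℕP.+-identityʳ _) (ℕP.+-identityʳ j)) ⟩
      chebCoeff j j
    ≡⟨ chebCoeff-leading j ⟩
      + U j 0
    ≡⟨ cong (λ L → + U L 0) (ℕP.+-identityʳ j) ⟨
      + U (j ℕ.+ 0) 0
    ≡⟨ ℤP.*-identityˡ _ ⟨
      + 1 * + U (j ℕ.+ 0) 0 ∎
  chebCoeff-U (suc k) zero = begin
      chebCoeff (suc k ℕ.+ suc k) 0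
    ≡⟨ cong (λ N → chebCoeff (suc N) 0) (ℕP.+-suc k k) ⟩
      - chebCoeff (k ℕ.+ k) 0
    ≡⟨ cong -_ (chebCoeff-U k 0) ⟩
      - (sgn k * + U k k)
    ≡⟨ cong (λ u → - (sgn k * + u)) (trans (U-diag k) (sym (U-diag (suc k)))) ⟩
      - (sgn k * + U (suc k) (suc k))
    ≡⟨ sgn-suc k _ ⟨
      sgn (suc k) * + U (suc k) (suc k) ∎
  chebCoeff-U (suc k) (suc j) = begin
      chebCoeff (suc j ℕ.+ suc k ℕ.+ suc k) (suc j)
    ≡⟨ cong (λ N → chebCoeff (suc N) (suc j)) degree ⟩
      + 2 * chebCoeff (suc (suc (j ℕ.+ k ℕ.+ k))) j - chebCoeff (suc j ℕ.+ k ℕ.+ k) (suc j)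
    ≡⟨ cong (λ N → + 2 * chebCoeff N j - chebCoeff (suc j ℕ.+ k ℕ.+ k) (suc j)) degree ⟨
      + 2 * chebCoeff (j ℕ.+ suc k ℕ.+ suc k) j - chebCoeff (suc j ℕ.+ k ℕ.+ k) (suc j)
    ≡⟨ cong₂ (λ a b → + 2 * a - b) (chebCoeff-U (suc k) j) (chebCoeff-U k (suc j)) ⟩
      + 2 * (sgn (suc k) * + U (j ℕ.+ suc k) (suc k)) - sgn k * + U (suc j ℕ.+ k) k
    ≡⟨ cong (λ L → + 2 * (sgn (suc k) * + U L (suc k)) - sgn k * + U (suc j ℕ.+ k) k) (ℕP.+-suc j k) ⟩
      + 2 * (sgn (suc k) * + U (suc L) (suc k)) - sgn k * + U (suc L) k
    ≡⟨ recurrence (sgn k) (+ U (suc L) k) (+ U (suc L) (suc k)) ⟩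
      sgn (suc k) * (+ U (suc L) k + + 2 * + U (suc L) (suc k))
    ≡⟨ cong (sgn (suc k) *_) (U-stepℤ L k) ⟨
      sgn (suc k) * + U (suc (suc L)) (suc k)
    ≡⟨ cong (λ L′ → sgn (suc k) * + U (suc L′) (suc k)) (ℕP.+-suc j k) ⟨
      sgn (suc k) * + U (suc j ℕ.+ suc k) (suc k) ∎
    where
    L = j ℕ.+ k
    degree : j ℕ.+ suc k ℕ.+ suc k ≡ suc (suc (j ℕ.+ k ℕ.+ k))
    degree = trans (ℕP.+-suc (j ℕ.+ suc k) k) (cong (λ m → suc (m ℕ.+ k)) (ℕP.+-suc j k))
    recurrence : ∀ s a b → + 2 * ((- + 1 * s) * b) - s * a ≡ (- + 1 * s) * (a + + 2 * b)
    recurrence = ℤRing.solve-∀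

  exponent : ∀ n k → + n - + k + + 1 ≡ suc n ⊖ k
  exponent n k = trans (reorder (+ n) (+ k)) (trans (cong (_- + k) (sym (ℤP.pos-+ 1 n))) (ℤP.[+m]-[+n]≡m⊖n (suc n) k))
    where
    reorder : ∀ a b → a - b + + 1 ≡ + 1 + a - b
    reorder = ℤRing.solve-∀

  -- (-1)^k t_{n,k} = U(n+1, k); for k > n+1 both sides vanish, the exponent
  -- n-k+1 of t_{n,k} being negative.
  signed-t : ∀ n k → sgn k * t n k ≡ + U (suc n) k
  signed-t n k with k ℕ.≤? suc n
  ... | yes k≤n+1 = begin
      sgn k * chebCoeffℤ (n ℕ.+ k ℕ.+ 1) (+ n - + k + + 1)
    ≡⟨ cong₂ (λ N e → sgn k * chebCoeffℤ N e) degree (trans (exponent n k) (ℤP.⊖-≥ k≤n+1)) ⟩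
      sgn k * chebCoeff (j ℕ.+ k ℕ.+ k) j
    ≡⟨ cong (sgn k *_) (chebCoeff-U k j) ⟩
      sgn k * (sgn k * + U (j ℕ.+ k) k)
    ≡⟨ ℤP.*-assoc (sgn k) (sgn k) _ ⟨
      (sgn k * sgn k) * + U (j ℕ.+ k) k
    ≡⟨ cong₂ (λ s L → s * + U L k) (sgn-square k) j+k≡n+1 ⟩
      + 1 * + U (suc n) k
    ≡⟨ ℤP.*-identityˡ _ ⟩
      + U (suc n) k ∎
    where
    j = suc n ∸ k
    j+k≡n+1 : j ℕ.+ k ≡ suc n
    j+k≡n+1 = ℕP.m∸n+n≡m k≤n+1
    degree : n ℕ.+ k ℕ.+ 1 ≡ j ℕ.+ k ℕ.+ k
    degree = trans (ℕP.+-comm (n ℕ.+ k) 1) (cong (ℕ._+ k) (sym j+k≡n+1))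
  ... | no k≰n+1 = begin
      sgn k * chebCoeffℤ (n ℕ.+ k ℕ.+ 1) (+ n - + k + + 1)
    ≡⟨ cong (λ e → sgn k * chebCoeffℤ (n ℕ.+ k ℕ.+ 1) e) (trans (exponent n k) (ℤP.⊖-< n+1<k)) ⟩
      sgn k * chebCoeffℤ (n ℕ.+ k ℕ.+ 1) (- + (k ∸ suc n))
    ≡⟨ cong (sgn k *_) (negative-exponent (ℕP.m<n⇒0<n∸m n+1<k)) ⟩
      sgn k * + 0
    ≡⟨ ℤP.*-zeroʳ (sgn k) ⟩
      + 0
    ≡⟨ cong +_ (U-vanish (suc n) k n+1<k) ⟨
      + U (suc n) k ∎
    where
    n+1<k : suc n ℕ.< k
    n+1<k = ℕP.≰⇒> k≰n+1
    negative-exponent : ∀ {N m} → 0 ℕ.< m → chebCoeffℤ N (- + m) ≡ + 0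
    negative-exponent {m = suc m} _ = refl

open Chebyshev using (sgn-suc; signed-t)

module Binomial where
  open import Data.Nat using (_+_; _*_)

  C↓ : ℕ → ℕ → ℕ
  C↓ n zero = 0
  C↓ n (suc k) = n C k

  pascal : ∀ n k → suc n C k ≡ C↓ n k + n C k
  pascal n zero = refl
  pascal n (suc k) = sym (nCk+nC[k+1]≡[n+1]C[k+1] n k)

  pascal₂ : ∀ m R → suc (suc m) C suc (suc R) ≡ m C R + 2 * (m C suc R) + m C suc (suc R)
  pascal₂ m R = begin
      suc (suc m) C suc (suc R)
    ≡⟨ nCk+nC[k+1]≡[n+1]C[k+1] (suc m) (suc R) ⟨
      suc m C suc R + suc m C suc (suc R)
    ≡⟨ cong₂ _+_ (nCk+nC[k+1]≡[n+1]C[k+1] m R) (nCk+nC[k+1]≡[n+1]C[k+1] m (suc R)) ⟨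
      (m C R + m C suc R) + (m C suc R + m C suc (suc R))
    ≡⟨ collect (m C R) (m C suc R) (m C suc (suc R)) ⟩
      m C R + 2 * (m C suc R) + m C suc (suc R) ∎
    where
    open ≡-Reasoning
    collect : ∀ a b c → (a + b) + (b + c) ≡ a + 2 * b + c
    collect = ℕRing.solve-∀

  pascal₂-1 : ∀ m → suc (suc m) C 1 ≡ 2 * (m C 0) + m C 1
  pascal₂-1 m = trans (nC1≡n (suc (suc m))) (cong (λ z → 2 + z) (sym (nC1≡n m)))

open Binomial

module AlternatingSum where
  open import Data.Integer using (_+_; _*_; _-_; -_)
  open ≡-Reasoning

  ∑ : ℕ → (ℕ → ℤ) → ℤ
  ∑ zero f = + 0
  ∑ (suc m) f = f 0 + ∑ m (λ i → f (suc i))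

  sumℤ-∑ : ∀ m f → sumℤ m f ≡ ∑ m f
  sumℤ-∑ m f = fold m f (λ i → i)
    where
    fold : ∀ m (f : ℕ → ℤ) (g : ℕ → ℕ) → foldr _+_ (+ 0) (map f (applyUpTo g m)) ≡ ∑ m (λ i → f (g i))
    fold zero f g = refl
    fold (suc m) f g = cong (λ z → f (g 0) + z) (fold m f (λ i → g (suc i)))

  ∑-cong : ∀ m {f g : ℕ → ℤ} → (∀ i → f i ≡ g i) → ∑ m f ≡ ∑ m g
  ∑-cong zero e = refl
  ∑-cong (suc m) e = cong₂ _+_ (e 0) (∑-cong m (λ i → e (suc i)))

  ∑-+ : ∀ m (f g : ℕ → ℤ) → ∑ m (λ i → f i + g i) ≡ ∑ m f + ∑ m g
  ∑-+ zero f g = refl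
  ∑-+ (suc m) f g =
    trans (cong (λ z → f 0 + g 0 + z) (∑-+ m (λ i → f (suc i)) (λ i → g (suc i))))
          (interchange (f 0) (g 0) _ _)
    where
    interchange : ∀ a b c d → a + b + (c + d) ≡ a + c + (b + d)
    interchange = ℤRing.solve-∀

  ∑-neg : ∀ m (f : ℕ → ℤ) → ∑ m (λ i → - f i) ≡ - ∑ m f
  ∑-neg zero f = refl
  ∑-neg (suc m) f =
    trans (cong (λ z → - f 0 + z) (∑-neg m (λ i → f (suc i))))
          (sym (ℤP.neg-distrib-+ (f 0) _))

  ∑-snoc : ∀ m (f : ℕ → ℤ) → ∑ (suc m) f ≡ ∑ m f + f m
  ∑-snoc zero f = ℤP.+-comm (f 0) (+ 0)
  ∑-snoc (suc m) f =
    trans (cong (λ z → f 0 + z) (∑-snoc m (λ i → f (suc i)))) (sym (ℤP.+-assoc (f 0) _ _))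

  -- The n-th iterated difference of h at 0; alternating-sum-Δ shows that it
  -- equals Σ_i (-1)^i C(n,i) h(i).
  Δ : ℕ → (ℕ → ℤ) → ℤ
  Δ zero h = h 0
  Δ (suc n) h = Δ n h - Δ n (λ i → h (suc i))

  term : ℕ → (ℕ → ℤ) → ℕ → ℤ
  term n h i = sgn i * + (n C i) * h i

  -- By Pascal's rule each term for n+1 splits into a C(n,i)-term and a
  -- C(n,i-1)-term; the latter, shifted by one, are the negated terms for h ∘ suc.
  lower : ℕ → (ℕ → ℤ) → ℕ → ℤ
  lower n h i = sgn i * + C↓ n i * h i

  term-split : ∀ n h i → term (suc n) h i ≡ term n h i + lower n h i
  term-split n h i = begin
      sgn i * + (suc n C i) * h i
    ≡⟨ cong (λ c → sgn i * c * h i) (trans (cong +_ (pascal n i)) (ℤP.pos-+ (C↓ n i) (n C i))) ⟩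
      sgn i * (+ C↓ n i + + (n C i)) * h i
    ≡⟨ distribute (sgn i) (+ C↓ n i) (+ (n C i)) (h i) ⟩
      term n h i + lower n h i ∎
    where
    distribute : ∀ s a b x → s * (a + b) * x ≡ s * b * x + s * a * x
    distribute = ℤRing.solve-∀

  lower-shift : ∀ n h i → lower n h (suc i) ≡ - term n (λ j → h (suc j)) i
  lower-shift n h i = begin
      sgn (suc i) * + (n C i) * h (suc i)
    ≡⟨ ℤP.*-assoc (sgn (suc i)) _ _ ⟩
      sgn (suc i) * (+ (n C i) * h (suc i))
    ≡⟨ sgn-suc i _ ⟩
      - (sgn i * (+ (n C i) * h (suc i)))
    ≡⟨ cong -_ (ℤP.*-assoc (sgn i) _ _) ⟨
      - (sgn i * + (n C i) * h (suc i)) ∎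

  alternating-sum-Δ : ∀ n h → ∑ (suc n) (term n h) ≡ Δ n h
  alternating-sum-Δ zero h = trans (ℤP.+-identityʳ _) (ℤP.*-identityˡ (h 0))
  alternating-sum-Δ (suc n) h = begin
      ∑ (suc (suc n)) (term (suc n) h)
    ≡⟨ ∑-cong (suc (suc n)) (term-split n h) ⟩
      ∑ (suc (suc n)) (λ i → term n h i + lower n h i)
    ≡⟨ ∑-+ (suc (suc n)) (term n h) (lower n h) ⟩
      ∑ (suc (suc n)) (term n h) + ∑ (suc (suc n)) (lower n h)
    ≡⟨ cong₂ _+_ upper-sum lower-sum ⟩
      Δ n h - Δ n h′ ∎
    where
    h′ : ℕ → ℤ
    h′ i = h (suc i)
    -- The last C(n,i)-term has C(n,n+1) = 0.
    upper-sum : ∑ (suc (suc n)) (term n h) ≡ Δ n h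
    upper-sum = begin
        ∑ (suc (suc n)) (term n h)
      ≡⟨ ∑-snoc (suc n) (term n h) ⟩
        ∑ (suc n) (term n h) + sgn (suc n) * + (n C suc n) * h (suc n)
      ≡⟨ cong (λ c → ∑ (suc n) (term n h) + sgn (suc n) * + c * h (suc n)) (k>n⇒nCk≡0 (ℕP.n<1+n n)) ⟩
        ∑ (suc n) (term n h) + sgn (suc n) * + 0 * h (suc n)
      ≡⟨ cong (λ z → ∑ (suc n) (term n h) + z * h (suc n)) (ℤP.*-zeroʳ (sgn (suc n))) ⟩
        ∑ (suc n) (term n h) + + 0
      ≡⟨ ℤP.+-identityʳ _ ⟩
        ∑ (suc n) (term n h)
      ≡⟨ alternating-sum-Δ n h ⟩
        Δ n h ∎
    -- The first C(n,i-1)-term has C(n,-1) = 0.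
    lower-sum : ∑ (suc (suc n)) (lower n h) ≡ - Δ n h′
    lower-sum = begin
        + 0 + ∑ (suc n) (λ i → lower n h (suc i))
      ≡⟨ ℤP.+-identityˡ _ ⟩
        ∑ (suc n) (λ i → lower n h (suc i))
      ≡⟨ ∑-cong (suc n) (lower-shift n h) ⟩
        ∑ (suc n) (λ i → - term n h′ i)
      ≡⟨ ∑-neg (suc n) (term n h′) ⟩
        - ∑ (suc n) (term n h′)
      ≡⟨ cong -_ (alternating-sum-Δ n h′) ⟩
        - Δ n h′ ∎

  Δ-cong : ∀ n {h h′ : ℕ → ℤ} → (∀ i → i ℕ.≤ n → h i ≡ h′ i) → Δ n h ≡ Δ n h′
  Δ-cong zero e = e 0 z≤n
  Δ-cong (suc n) e =
    cong₂ _-_ (Δ-cong n (λ i i≤n → e i (ℕP.m≤n⇒m≤1+n i≤n))) (Δ-cong n (λ i i≤n → e (suc i) (s≤s i≤n)))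

  Δ-+ : ∀ n (a b : ℕ → ℤ) → Δ n (λ i → a i + b i) ≡ Δ n a + Δ n b
  Δ-+ zero a b = refl
  Δ-+ (suc n) a b =
    trans (cong₂ _-_ (Δ-+ n a b) (Δ-+ n (λ i → a (suc i)) (λ i → b (suc i))))
          (interchange (Δ n a) (Δ n b) (Δ n (λ i → a (suc i))) (Δ n (λ i → b (suc i))))
    where
    interchange : ∀ x y z w → (x + y) - (z + w) ≡ (x - z) + (y - w)
    interchange = ℤRing.solve-∀

  Δ-scale : ∀ n c (a : ℕ → ℤ) → Δ n (λ i → c * a i) ≡ c * Δ n a
  Δ-scale zero c a = refl
  Δ-scale (suc n) c a =
    trans (cong₂ _-_ (Δ-scale n c a) (Δ-scale n c (λ i → a (suc i)))) (factor c _ _)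
    where
    factor : ∀ c x y → c * x - c * y ≡ c * (x - y)
    factor = ℤRing.solve-∀

  odd : ℕ → ℕ → ℕ
  odd n i = 2 ℕ.* n ∸ 2 ℕ.* i ℕ.+ 1

  odd-step : ∀ n i → i ℕ.≤ n → odd (suc n) i ≡ suc (suc (odd n i))
  odd-step n i i≤n =
    cong (ℕ._+ 1) (trans (cong (_∸ 2 ℕ.* i) (ℕP.*-suc 2 n)) (ℕP.+-∸-assoc 2 (ℕP.*-monoʳ-≤ 2 i≤n)))

  odd-shift : ∀ n i → odd (suc n) (suc i) ≡ odd n i
  odd-shift n i = cong (ℕ._+ 1) (cong₂ _∸_ (ℕP.*-suc 2 n) (ℕP.*-suc 2 i))

  -- Φ n R = Σ_i (-1)^i C(n,i) C(2n-2i+1, R).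
  Φ : ℕ → ℕ → ℤ
  Φ n R = Δ n (λ i → + (odd n i C R))

  -- One difference step raises every top entry by 2 (and shifts the index).
  Φ-step : ∀ n R → Φ (suc n) R ≡ Δ n (λ i → + (suc (suc (odd n i)) C R)) - Φ n R
  Φ-step n R = cong₂ _-_ (Δ-cong n (λ i i≤n → cong (λ m → + (m C R)) (odd-step n i i≤n)))
                         (Δ-cong n (λ i _ → cong (λ m → + (m C R)) (odd-shift n i)))

  -- By pascal₂, the recursion of Φ in (n, R) is that of U.
  Φ-0 : ∀ n → Φ (suc n) 0 ≡ + 0
  Φ-0 n = trans (Φ-step n 0) (ℤP.+-inverseʳ (Φ n 0))

  Φ-1 : ∀ n → Φ (suc n) 1 ≡ + 2 * Φ n 0
  Φ-1 n = begin
      Φ (suc n) 1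
    ≡⟨ Φ-step n 1 ⟩
      Δ n (λ i → + (suc (suc (odd n i)) C 1)) - Φ n 1
    ≡⟨ cong (_- Φ n 1) (Δ-cong n (λ i _ → expand (odd n i))) ⟩
      Δ n (λ i → + 2 * + (odd n i C 0) + + (odd n i C 1)) - Φ n 1
    ≡⟨ cong (_- Φ n 1) (trans (Δ-+ n _ _) (cong (_+ Φ n 1) (Δ-scale n (+ 2) _))) ⟩
      (+ 2 * Φ n 0 + Φ n 1) - Φ n 1
    ≡⟨ cancel (Φ n 0) (Φ n 1) ⟩
      + 2 * Φ n 0 ∎
    where
    expand : ∀ m → + (suc (suc m) C 1) ≡ + 2 * + (m C 0) + + (m C 1)
    expand m = trans (cong +_ (pascal₂-1 m))
                     (trans (ℤP.pos-+ (2 ℕ.* (m C 0)) _) (cong (_+ + (m C 1)) (ℤP.pos-* 2 (m C 0))))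
    cancel : ∀ a b → (+ 2 * a + b) - b ≡ + 2 * a
    cancel = ℤRing.solve-∀

  Φ-2 : ∀ n R → Φ (suc n) (suc (suc R)) ≡ Φ n R + + 2 * Φ n (suc R)
  Φ-2 n R = begin
      Φ (suc n) (suc (suc R))
    ≡⟨ Φ-step n (suc (suc R)) ⟩
      Δ n (λ i → + (suc (suc (odd n i)) C suc (suc R))) - Φ n (suc (suc R))
    ≡⟨ cong (_- Φ n (suc (suc R))) (Δ-cong n (λ i _ → expand (odd n i))) ⟩
      Δ n (λ i → (a i + + 2 * b i) + c i) - Φ n (suc (suc R))
    ≡⟨ cong (_- Φ n (suc (suc R))) linear ⟩
      (Φ n R + + 2 * Φ n (suc R) + Φ n (suc (suc R))) - Φ n (suc (suc R))
    ≡⟨ cancel (Φ n R) (Φ n (suc R)) (Φ n (suc (suc R))) ⟩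
      Φ n R + + 2 * Φ n (suc R) ∎
    where
    a b c : ℕ → ℤ
    a i = + (odd n i C R)
    b i = + (odd n i C suc R)
    c i = + (odd n i C suc (suc R))
    expand : ∀ m → + (suc (suc m) C suc (suc R)) ≡ (+ (m C R) + + 2 * + (m C suc R)) + + (m C suc (suc R))
    expand m = trans (cong +_ (pascal₂ m R))
      (trans (ℤP.pos-+ (m C R ℕ.+ 2 ℕ.* (m C suc R)) _)
             (cong (_+ + (m C suc (suc R))) (trans (ℤP.pos-+ (m C R) _)
                                                     (cong (λ z → + (m C R) + z) (ℤP.pos-* 2 (m C suc R))))))
    linear : Δ n (λ i → (a i + + 2 * b i) + c i) ≡ Φ n R + + 2 * Φ n (suc R) + Φ n (suc (suc R))
    linear = trans (Δ-+ n (λ i → a i + + 2 * b i) c)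
                   (cong (_+ Φ n (suc (suc R))) (trans (Δ-+ n a (λ i → + 2 * b i))
                                                       (cong (λ z → Φ n R + z) (Δ-scale n (+ 2) b))))
    cancel : ∀ x y z → (x + + 2 * y + z) - z ≡ x + + 2 * y
    cancel = ℤRing.solve-∀

  Φ-vanish : ∀ n R → R ℕ.< n → Φ n R ≡ + 0
  Φ-vanish (suc n) 0 _ = Φ-0 n
  Φ-vanish (suc n) 1 (s≤s 0<n) = trans (Φ-1 n) (cong (+ 2 *_) (Φ-vanish n 0 0<n))
  Φ-vanish (suc n) (suc (suc R)) (s≤s R+1<n) =
    trans (Φ-2 n R) (cong₂ (λ x y → x + + 2 * y) (Φ-vanish n R (ℕP.<-trans (ℕP.n<1+n R) R+1<n))
                                                  (Φ-vanish n (suc R) R+1<n))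

  Φ-U : ∀ n k → Φ n (n ℕ.+ k) ≡ + U (suc n) k
  Φ-U zero zero = refl
  Φ-U zero (suc zero) = refl
  Φ-U zero (suc (suc k)) = cong +_ (k>n⇒nCk≡0 {1} {suc (suc k)} (s≤s (s≤s z≤n)))
  Φ-U (suc zero) zero = Φ-1 0
  Φ-U (suc (suc n)) zero = begin
      Φ (suc (suc n)) (suc (suc (n ℕ.+ 0)))
    ≡⟨ Φ-2 (suc n) (n ℕ.+ 0) ⟩
      Φ (suc n) (n ℕ.+ 0) + + 2 * Φ (suc n) (suc n ℕ.+ 0)
    ≡⟨ cong₂ (λ x y → x + + 2 * y) (Φ-vanish (suc n) (n ℕ.+ 0) (s≤s (ℕP.≤-reflexive (ℕP.+-identityʳ n))))
                                   (Φ-U (suc n) zero) ⟩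
      + 0 + + 2 * + U (suc (suc n)) 0
    ≡⟨ ℤP.+-identityˡ _ ⟩
      + 2 * + U (suc (suc n)) 0
    ≡⟨ U-step₀ℤ (suc n) ⟨
      + U (suc (suc (suc n))) 0 ∎
  Φ-U (suc n) (suc k) = begin
      Φ (suc n) (suc (n ℕ.+ suc k))
    ≡⟨ cong (λ R → Φ (suc n) (suc R)) (ℕP.+-suc n k) ⟩
      Φ (suc n) (suc (suc (n ℕ.+ k)))
    ≡⟨ Φ-2 n (n ℕ.+ k) ⟩
      Φ n (n ℕ.+ k) + + 2 * Φ n (suc (n ℕ.+ k))
    ≡⟨ cong₂ (λ x y → x + + 2 * y) (Φ-U n k) (trans (cong (Φ n) (sym (ℕP.+-suc n k))) (Φ-U n (suc k))) ⟩
      + U (suc n) k + + 2 * + U (suc n) (suc k)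
    ≡⟨ U-stepℤ n k ⟨
      + U (suc (suc n)) (suc k) ∎

  alternating-sum-U : ∀ n k →
    sumℤ (suc n) (λ i → sgn i * + (n C i) * + (odd n i C (n ℕ.+ k))) ≡ + U (suc n) k
  alternating-sum-U n k = begin
      sumℤ (suc n) (term n (λ i → + (odd n i C (n ℕ.+ k))))
    ≡⟨ sumℤ-∑ (suc n) (term n (λ i → + (odd n i C (n ℕ.+ k)))) ⟩
      ∑ (suc n) (term n (λ i → + (odd n i C (n ℕ.+ k))))
    ≡⟨ alternating-sum-Δ n _ ⟩
      Φ n (n ℕ.+ k)
    ≡⟨ Φ-U n k ⟩
      + U (suc n) k ∎

open AlternatingSum using (alternating-sum-U)

module ClosedForm where
  open import Data.Nat using (_+_; _*_; _^_; _≤_; _<_)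
  open ≡-Reasoning

  -- Multiplying by 2^k clears the possibly negative exponent n - k.
  U-closed : ∀ n k → 2 ^ k * U (suc n) k ≡ 2 ^ n * (n C k + 2 * C↓ n k)
  U-closed zero zero = refl
  U-closed zero (suc zero) = refl
  U-closed zero (suc (suc k))
    rewrite k>n⇒nCk≡0 {0} {suc (suc k)} (s≤s z≤n) | k>n⇒nCk≡0 {0} {suc k} (s≤s z≤n) =
    ℕP.*-zeroʳ (2 ^ suc (suc k))
  U-closed (suc n) zero = begin
      1 * (2 * U (suc n) 0)
    ≡⟨ ℕP.*-identityˡ _ ⟩
      2 * U (suc n) 0
    ≡⟨ cong (2 *_) (ℕP.*-identityˡ (U (suc n) 0)) ⟨
      2 * (1 * U (suc n) 0)
    ≡⟨ cong (2 *_) (U-closed n zero) ⟩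
      2 * (2 ^ n * (1 + 2 * 0))
    ≡⟨ ℕP.*-assoc 2 (2 ^ n) _ ⟨
      2 * 2 ^ n * (1 + 2 * 0) ∎
  U-closed (suc n) (suc k) = begin
      2 ^ suc k * (U (suc n) k + 2 * U (suc n) (suc k))
    ≡⟨ spread (2 ^ k) (U (suc n) k) (U (suc n) (suc k)) ⟩
      2 * (2 ^ k * U (suc n) k) + 2 * (2 ^ suc k * U (suc n) (suc k))
    ≡⟨ cong₂ (λ x y → 2 * x + 2 * y) (U-closed n k) (U-closed n (suc k)) ⟩
      2 * (2 ^ n * (n C k + 2 * C↓ n k)) + 2 * (2 ^ n * (n C suc k + 2 * (n C k)))
    ≡⟨ regroup (2 ^ n) (n C k) (n C suc k) (C↓ n k) ⟩
      2 * 2 ^ n * ((n C k + n C suc k) + 2 * (C↓ n k + n C k))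
    ≡⟨ cong₂ (λ x y → 2 * 2 ^ n * (x + 2 * y)) (nCk+nC[k+1]≡[n+1]C[k+1] n k) (sym (pascal n k)) ⟩
      2 * 2 ^ n * (suc n C suc k + 2 * (suc n C k)) ∎
    where
    spread : ∀ q a b → 2 * q * (a + 2 * b) ≡ 2 * (q * a) + 2 * (2 * q * b)
    spread = ℕRing.solve-∀
    regroup : ∀ p a b c → 2 * (p * (a + 2 * c)) + 2 * (p * (b + 2 * a)) ≡ 2 * p * ((a + b) + 2 * (c + a))
    regroup = ℕRing.solve-∀

  U-closed-≤ : ∀ {n k} → k ≤ n → U (suc n) k ≡ 2 ^ (n ∸ k) * (n C k + 2 * C↓ n k)
  U-closed-≤ {n} {k} k≤n = ℕP.*-cancelˡ-≡ _ _ (2 ^ k) {{ℕP.m^n≢0 2 k}} (begin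
      2 ^ k * U (suc n) k
    ≡⟨ U-closed n k ⟩
      2 ^ n * B
    ≡⟨ cong (λ e → 2 ^ e * B) (ℕP.m+[n∸m]≡n k≤n) ⟨
      2 ^ (k + (n ∸ k)) * B
    ≡⟨ cong (_* B) (ℕP.^-distribˡ-+-* 2 k (n ∸ k)) ⟩
      2 ^ k * 2 ^ (n ∸ k) * B
    ≡⟨ ℕP.*-assoc (2 ^ k) _ B ⟩
      2 ^ k * (2 ^ (n ∸ k) * B) ∎)
    where
    B = n C k + 2 * C↓ n k

  /1-* : ∀ a b → (+ a ℚ./ 1) ℚ.* (+ b ℚ./ 1) ≡ + (a * b) ℚ./ 1
  /1-* a b = trans (cong₂ ℚ._*_ (/1-normal a) (/1-normal b)) (cong (ℚ._/ 1) (sym (ℤP.pos-* a b)))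
    where
    /1-normal : ∀ a → + a ℚ./ 1 ≡ ℚ.mkℚ (+ a) 0 (coprime-sym (1-coprimeTo a))
    /1-normal a = ℚP.normalize-coprime (coprime-sym (1-coprimeTo a))

  binomℤ-pred : ∀ n k → binomℤ n (+ k ℤ.- + 1) ≡ + C↓ n k
  binomℤ-pred n zero = refl
  binomℤ-pred n (suc k) =
    cong (binomℤ n) (trans (ℤP.[+m]-[+n]≡m⊖n (suc k) 1) (trans (ℤP.[1+m]⊖[1+n]≡m⊖n k 0) (ℤP.⊖-≥ z≤n)))

  closed-form : ∀ n k →
    + U (suc n) k ℚ./ 1 ≡ pow2 (+ n ℤ.- + k) ℚ.* ((+ (n C k) ℤ.+ + 2 ℤ.* binomℤ n (+ k ℤ.- + 1)) ℚ./ 1)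
  closed-form n k = trans (by-cases (ℕP.<-cmp k (suc n))) (cong (λ z → pow2 (+ n ℤ.- + k) ℚ.* (z ℚ./ 1)) (sym B≡))
    where
    B = n C k + 2 * C↓ n k
    B≡ : + (n C k) ℤ.+ + 2 ℤ.* binomℤ n (+ k ℤ.- + 1) ≡ + B
    B≡ = trans (cong (λ z → + (n C k) ℤ.+ + 2 ℤ.* z) (binomℤ-pred n k))
               (sym (trans (ℤP.pos-+ (n C k) _) (cong (λ z → + (n C k) ℤ.+ z) (ℤP.pos-* 2 (C↓ n k)))))
    by-cases : Tri (k < suc n) (k ≡ suc n) (suc n < k) → + U (suc n) k ℚ./ 1 ≡ pow2 (+ n ℤ.- + k) ℚ.* (+ B ℚ./ 1)
    by-cases (tri< (s≤s k≤n) _ _) = begin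
        + U (suc n) k ℚ./ 1
      ≡⟨ cong (λ u → + u ℚ./ 1) (U-closed-≤ k≤n) ⟩
        + (2 ^ (n ∸ k) * B) ℚ./ 1
      ≡⟨ /1-* (2 ^ (n ∸ k)) B ⟨
        pow2 (+ (n ∸ k)) ℚ.* (+ B ℚ./ 1)
      ≡⟨ cong (λ e → pow2 e ℚ.* (+ B ℚ./ 1)) (trans (ℤP.[+m]-[+n]≡m⊖n n k) (ℤP.⊖-≥ k≤n)) ⟨
        pow2 (+ n ℤ.- + k) ℚ.* (+ B ℚ./ 1) ∎
    by-cases (tri≈ _ refl _) = begin
        + U (suc n) (suc n) ℚ./ 1
      ≡⟨ cong (λ u → + u ℚ./ 1) (U-diag (suc n)) ⟩
        pow2 -[1+ 0 ] ℚ.* (+ 2 ℚ./ 1)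
      ≡⟨ cong₂ (λ e b → pow2 e ℚ.* (+ b ℚ./ 1)) (sym exponent) (sym B≡2) ⟩
        pow2 (+ n ℤ.- + suc n) ℚ.* (+ B ℚ./ 1) ∎
      where
      exponent : + n ℤ.- + suc n ≡ -[1+ 0 ]
      exponent = trans (ℤP.[+m]-[+n]≡m⊖n n (suc n))
                       (trans (ℤP.⊖-< (ℕP.n<1+n n)) (cong (λ z → ℤ.- + z) (ℕP.m+n∸n≡m 1 n)))
      B≡2 : B ≡ 2
      B≡2 = cong₂ (λ x y → x + 2 * y) (k>n⇒nCk≡0 (ℕP.n<1+n n)) (nCn≡1 n)
    by-cases (tri> _ _ n+1<k) = begin
        + U (suc n) k ℚ./ 1
      ≡⟨ cong (λ u → + u ℚ./ 1) (U-vanish (suc n) k n+1<k) ⟩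
        + 0 ℚ./ 1
      ≡⟨ ℚP.*-zeroʳ (pow2 (+ n ℤ.- + k)) ⟨
        pow2 (+ n ℤ.- + k) ℚ.* (+ 0 ℚ./ 1)
      ≡⟨ cong (λ b → pow2 (+ n ℤ.- + k) ℚ.* (+ b ℚ./ 1)) (sym B≡0) ⟩
        pow2 (+ n ℤ.- + k) ℚ.* (+ B ℚ./ 1) ∎
      where
      C↓-vanish : ∀ k → suc n < k → C↓ n k ≡ 0
      C↓-vanish (suc k) (s≤s n<k) = k>n⇒nCk≡0 n<k
      B≡0 : B ≡ 0
      B≡0 = cong₂ (λ x y → x + 2 * y) (k>n⇒nCk≡0 (ℕP.<-trans (ℕP.n<1+n n) n+1<k)) (C↓-vanish k n+1<k)

open ClosedForm using (closed-form)

proposition3 : (n k : ℕ) → .{{_ : NonZero n}} →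
    (sgn k ℤ.* t n k ≡ + numU (suc n) k)
    × (sgn k ℤ.* t n k ≡ sumℤ (suc n) (λ i → sgn i ℤ.* (+ (n C i)) ℤ.* (+ ((2 ℕ.* n ∸ 2 ℕ.* i ℕ.+ 1) C (n ℕ.+ k)))))
    × (ℚ._/_ (sgn k ℤ.* t n k) 1 ≡ pow2 ((+ n) ℤ.- (+ k)) ℚ.* ((ℚ._/_ (+ (n C k) ℤ.+ + 2 ℤ.* binomℤ n ((+ k) ℤ.- + 1)) 1)))
proposition3 n k =
  trans (signed-t n k) (cong +_ (sym (numU-U (suc n) k))) ,
  trans (signed-t n k) (sym (alternating-sum-U n k)) ,
  trans (cong (ℚ._/ 1) (signed-t n k)) (closed-form n k)
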